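{- For every labelled transition system $T$, the labelled transition system $\mathsf{ks}^{ -1}(Q)$, where $Q$ is the quotient of the Kripke structure $\mathsf{ks}(T)$ with respect to bisimilarity, is isomorphic to the quotient of $T$ with respect to strong bisimilarity; i.e. $\mathrm{min}^{\leftrightarrow}_{\mathsf{LTS}}=\mathsf{ks}^{ -1}\circ\mathrm{min}^{\leftrightarrow}_{\mathsf{KS}}\circ\mathsf{ks}$.
   Context: A Kripke structure is $K=\langle S, AP, \to, L\rangle$ with $S$ a set of states, $AP$ a set of atomic propositions, $\to\,\subseteq S\times S$ a total transition relation, and $L: S\to 2^{AP}$. A labelled transition system (LTS) is $T=\langle S, Act, \to\rangle$ with a special silent action $\tau\notin Act$ and a total transition relation $\to\,\subseteq S\times(Act\cup\{\tau\})\times S$. The embedding $\mathsf{ks}$: $\mathsf{ks}(T)=\langle S', AP, \to', L\rangle$ where $S' = S\cup\{(s,a,t)\in\,\to \mid a\neq\tau\}$, $AP = Act\cup\{\bot\}$ with $\bot\notin Act$ fresh, $\to'$ is the least relation such that for every transition $(s,a,t)$ with $a\neq\tau$, $s\to'(s,a,t)$ and $(s,a,t)\to' t$, and $s\to' t$ whenever $s\xrightarrow{\tau}t$; $L(s)=\{\bot\}$ for $s\in S$ and $L((s,a,t))=\{a\}$. Reversibility: a Kripke structure is reversible iff (1) $AP = Act\cup\{\bot\}$ for some set $Act$; (2) $|L(s)|=1$ for all states; (3) for every $s$ with $\bot\notin L(s)$, $s\to s'$ and $s\to s''$ imply $s'=s''$ and $L(s')=\{\bot\}$. For a reversible $K$,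 $\mathsf{ks}^{ -1}(K)=\langle S'',Act,\to''\rangle$ with $S''=\{s\mid L(s)=\{\bot\}\}$, $Act=AP\setminus\{\bot\}$, and $\to''$ the least relation with $s\xrightarrow{\tau}s'$ whenever $s\to s'$ and $L(s)=L(s')$, and $s\xrightarrow{a}s'$ whenever $s\to s''$, $a\in L(s'')\setminus\{\bot\}$ and $s''\to s'$. Bisimilarity in a Kripke structure: $B$ is a simulation iff for all $(s,s')\in B$, $L(s)=L(s')$ and each $s\to t$ is matched by some $s'\to t'$ with $(t,t')\in B$; bisimilar iff some symmetric simulation contains the pair. Strong bisimilarity in an LTS: same without the label condition, each $s\xrightarrow{a}t$ matched by $s'\xrightarrow{a}t'$ with $(t,t')\in B$. Quotients, $[s]$ the class: bisimilarity quotient of a Kripke structure: classes as states, $[s]\to[t]$ iff $s_1\to t_1$ for some $s_1\in[s],t_1\in[t]$, $L([s])=L(s)$; strong bisimilarity quotient of an LTS: classes as states, $[s]\xrightarrow{a}[t]$ iff $s_1\xrightarrow{a}t_1$ for some representatives. $\mathrm{min}$ maps a structure to (a fixed representative of) its quotient; equality is up to isomorphism. -}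

module Defs where

open import Level using (Level)
open import Data.Product using (Σ; Σ-syntax; _×_; _,_; proj₁; proj₂)
open import Data.Sum using (_⊎_; inj₁; inj₂)
import Data.Empty
open import Relation.Nullary using (¬_)
open import Relation.Binary.PropositionalEquality using (_≡_; refl)
import Relation.Binary.PropositionalEquality as Eq
open import Relation.Binary.Structures using (IsEquivalence)

_⇔_ : ∀ {a b : Level} → Set a → Set b → Set _
P ⇔ Q = (P → Q) × (Q → P)

_≐_ : {X : Set} → (X → Set) → (X → Set) → Set
P ≐ Q = ∀ x → P x ⇔ Q x

≐-refl : {X : Set} {P : X → Set} → P ≐ P
≐-refl x = (λ p → p) , (λ p → p)

≐-sym : {X : Set} {P Q : X → Set} → P ≐ Q → Q ≐ P
≐-sym e x = proj₂ (e x) , proj₁ (e x)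

≐-trans : {X : Set} {P Q R : X → Set} → P ≐ Q → Q ≐ R → P ≐ R
≐-trans e f x = (λ p → proj₁ (f x) (proj₁ (e x) p)) , (λ r → proj₂ (e x) (proj₂ (f x) r))

data Lab (A : Set) : Set where
  τ   : Lab A
  act : A → Lab A

data Atom (A : Set) : Set where
  ⊥ₚ : Atom A
  at : A → Atom A

IsBot : {A : Set} → (Atom A → Set) → Set
IsBot {A} P = ∀ (q : Atom A) → P q ⇔ (q ≡ ⊥ₚ)

record LTS (A : Set) : Set₁ where
  field
    State   : Set
    _⟶[_]_ : State → Lab A → State → Set
    total   : ∀ s → Σ[ l ∈ Lab A ] Σ[ t ∈ State ] (s ⟶[ l ] t)

record KS (P : Set) : Set₁ where
  field
    State : Set
    _⟶_  : State → State → Set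
    L     : State → P → Set
    total : ∀ s → Σ[ t ∈ State ] (s ⟶ t)

-- Setoid-presented structures: states up to an equivalence _≈_.
-- Quotients are presented this way (a quotient state [s] is s itself,
-- with [s] = [t] meaning s ≈ t).

record SLTS (A : Set) : Set₂ where
  field
    State         : Set
    _≈_           : State → State → Set₁
    isEquivalence : IsEquivalence _≈_
    _⟶[_]_       : State → Lab A → State → Set₁
    total         : ∀ s → Σ[ l ∈ Lab A ] Σ[ t ∈ State ] (s ⟶[ l ] t)

record SKS (P : Set) : Set₂ where
  field
    State         : Set
    _≈_           : State → State → Set₁
    isEquivalence : IsEquivalence _≈_
    _⟶_          : State → State → Set₁
    L             : State → P → Set
    total         : ∀ s → Σ[ t ∈ State ] (s ⟶ t)

module KSBisim {P : Set} (K : KS P) where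
  open KS K

  IsSimulation : (State → State → Set) → Set
  IsSimulation B = ∀ {s s'} → B s s' →
    (L s ≐ L s') × (∀ {t} → s ⟶ t → Σ[ t' ∈ State ] ((s' ⟶ t') × B t t'))

  IsSymmetric : (State → State → Set) → Set
  IsSymmetric B = ∀ {s s'} → B s s' → B s' s

  Bisimilar : State → State → Set₁
  Bisimilar s s' = Σ[ B ∈ (State → State → Set) ] (IsSimulation B × IsSymmetric B × B s s')

  bisim-refl : ∀ {s} → Bisimilar s s
  bisim-refl = _≡_ , (λ { refl → ≐-refl , λ {t} st → t , st , refl }) , Eq.sym , refl

  bisim-sym : ∀ {s s'} → Bisimilar s s' → Bisimilar s' s
  bisim-sym (B , sim , sy , b) = B , sim , sy , sy b

  bisim-trans : ∀ {s s' s''} → Bisimilar s s' → Bisimilar s' s'' → Bisimilar s s''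
  bisim-trans {s} {s'} {s''} (B₁ , sim₁ , sy₁ , b₁) (B₂ , sim₂ , sy₂ , b₂) =
    R , simR , syR , inj₁ (s' , b₁ , b₂)
    where
    R : State → State → Set
    R x z = (Σ[ y ∈ State ] (B₁ x y × B₂ y z)) ⊎ (Σ[ y ∈ State ] (B₂ x y × B₁ y z))
    syR : IsSymmetric R
    syR (inj₁ (y , p , q)) = inj₂ (y , sy₂ q , sy₁ p)
    syR (inj₂ (y , p , q)) = inj₁ (y , sy₁ q , sy₂ p)
    simR : IsSimulation R
    simR (inj₁ (y , p , q)) =
      ≐-trans (proj₁ (sim₁ p)) (proj₁ (sim₂ q)) ,
      λ st → let (y' , sy , p') = proj₂ (sim₁ p) st
                 (z' , sz , q') = proj₂ (sim₂ q) sy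
             in z' , sz , inj₁ (y' , p' , q')
    simR (inj₂ (y , p , q)) =
      ≐-trans (proj₁ (sim₂ p)) (proj₁ (sim₁ q)) ,
      λ st → let (y' , sy , p') = proj₂ (sim₂ p) st
                 (z' , sz , q') = proj₂ (sim₁ q) sy
             in z' , sz , inj₂ (y' , p' , q')

  bisim-isEquivalence : IsEquivalence Bisimilar
  bisim-isEquivalence = record { refl = bisim-refl ; sym = bisim-sym ; trans = bisim-trans }

module LTSBisim {A : Set} (T : LTS A) where
  open LTS T

  IsSimulation : (State → State → Set) → Set
  IsSimulation B = ∀ {s s'} → B s s' → ∀ {a t} → s ⟶[ a ] t →
    Σ[ t' ∈ State ] ((s' ⟶[ a ] t') × B t t')

  IsSymmetric : (State → State → Set) → Set
  IsSymmetric B = ∀ {s s'} → B s s' → B s' s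

  Bisimilar : State → State → Set₁
  Bisimilar s s' = Σ[ B ∈ (State → State → Set) ] (IsSimulation B × IsSymmetric B × B s s')

  bisim-refl : ∀ {s} → Bisimilar s s
  bisim-refl = _≡_ , (λ { refl {a} {t} st → t , st , refl }) , Eq.sym , refl

  bisim-sym : ∀ {s s'} → Bisimilar s s' → Bisimilar s' s
  bisim-sym (B , sim , sy , b) = B , sim , sy , sy b

  bisim-trans : ∀ {s s' s''} → Bisimilar s s' → Bisimilar s' s'' → Bisimilar s s''
  bisim-trans {s} {s'} {s''} (B₁ , sim₁ , sy₁ , b₁) (B₂ , sim₂ , sy₂ , b₂) =
    R , simR , syR , inj₁ (s' , b₁ , b₂)
    where
    R : State → State → Set
    R x z = (Σ[ y ∈ State ] (B₁ x y × B₂ y z)) ⊎ (Σ[ y ∈ State ] (B₂ x y × B₁ y z))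
    syR : IsSymmetric R
    syR (inj₁ (y , p , q)) = inj₂ (y , sy₂ q , sy₁ p)
    syR (inj₂ (y , p , q)) = inj₁ (y , sy₁ q , sy₂ p)
    simR : IsSimulation R
    simR (inj₁ (y , p , q)) st =
      let (y' , sy , p') = sim₁ p st
          (z' , sz , q') = sim₂ q sy
      in z' , sz , inj₁ (y' , p' , q')
    simR (inj₂ (y , p , q)) st =
      let (y' , sy , p') = sim₂ p st
          (z' , sz , q') = sim₁ q sy
      in z' , sz , inj₂ (y' , p' , q')

  bisim-isEquivalence : IsEquivalence Bisimilar
  bisim-isEquivalence = record { refl = bisim-refl ; sym = bisim-sym ; trans = bisim-trans }

module KsEmbed {A : Set} (T : LTS A) where
  open LTS T

  Trans : Set
  Trans = Σ[ s ∈ State ] Σ[ a ∈ A ] Σ[ t ∈ State ] (s ⟶[ act a ] t)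

  KState : Set
  KState = State ⊎ Trans

  data _⟶ₖ_ : KState → KState → Set where
    into  : ∀ {s a t} (p : s ⟶[ act a ] t) → inj₁ s ⟶ₖ inj₂ (s , a , t , p)
    outof : ∀ {s a t} (p : s ⟶[ act a ] t) → inj₂ (s , a , t , p) ⟶ₖ inj₁ t
    silent : ∀ {s t} → s ⟶[ τ ] t → inj₁ s ⟶ₖ inj₁ t

  Lₖ : KState → Atom A → Set
  Lₖ (inj₁ s) q = q ≡ ⊥ₚ
  Lₖ (inj₂ (s , a , t , p)) q = q ≡ at a

  totalₖ : ∀ x → Σ[ y ∈ KState ] (x ⟶ₖ y)
  totalₖ (inj₁ s) with total s
  ... | τ , t , p = inj₁ t , silent p
  ... | act a , t , p = inj₂ (s , a , t , p) , into p
  totalₖ (inj₂ (s , a , t , p)) = inj₁ t , outof p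

ks : {A : Set} → LTS A → KS (Atom A)
ks T = record { State = KState ; _⟶_ = _⟶ₖ_ ; L = Lₖ ; total = totalₖ }
  where open KsEmbed T

minKS : {P : Set} → KS P → SKS P
minKS {P} K = record
  { State = State
  ; _≈_ = Bisimilar
  ; isEquivalence = bisim-isEquivalence
  ; _⟶_ = λ s t → Σ[ s₁ ∈ State ] Σ[ t₁ ∈ State ] (Bisimilar s s₁ × Bisimilar t t₁ × (s₁ ⟶ t₁))
  ; L = L
  ; total = λ s → let (t , st) = total s in t , s , t , bisim-refl , bisim-refl , st
  }
  where open KS K
        open KSBisim K

minLTS : {A : Set} → LTS A → SLTS A
minLTS {A} T = record
  { State = State
  ; _≈_ = Bisimilar
  ; isEquivalence = bisim-isEquivalence
  ; _⟶[_]_ = λ s a t → Σ[ s₁ ∈ State ] Σ[ t₁ ∈ State ] (Bisimilar s s₁ × Bisimilar t t₁ × (s₁ ⟶[ a ] t₁))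
  ; total = λ s → let (a , t , st) = total s in a , t , s , t , bisim-refl , bisim-refl , st
  }
  where open LTS T
        open LTSBisim T

-- Reversibility (condition (1), AP = Act ∪ {⊥}, is built into the type)

record Reversible {A : Set} (K : SKS (Atom A)) : Set₁ where
  open SKS K
  field
    singleton : ∀ s → Σ[ p ∈ Atom A ] (∀ q → L s q ⇔ (q ≡ p))
    determ : ∀ s → ¬ L s ⊥ₚ → ∀ {s' s''} → s ⟶ s' → s ⟶ s'' → (s' ≈ s'') × IsBot (L s')

module KsInv {A : Set} (K : SKS (Atom A)) (r : Reversible K) where
  open SKS K
  open Reversible r

  IState : Set
  IState = Σ[ s ∈ State ] IsBot (L s)

  _⟶ᵢ[_]_ : IState → Lab A → IState → Set₁
  (s , _) ⟶ᵢ[ τ ] (s' , _) = (s ⟶ s') × (L s ≐ L s')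
  (s , _) ⟶ᵢ[ act a ] (s' , _) = Σ[ s'' ∈ State ] ((s ⟶ s'') × L s'' (at a) × (s'' ⟶ s'))

  isEqᵢ : IsEquivalence {A = IState} (λ x y → proj₁ x ≈ proj₁ y)
  isEqᵢ = record { refl = IsEquivalence.refl isEquivalence
                 ; sym = IsEquivalence.sym isEquivalence
                 ; trans = IsEquivalence.trans isEquivalence }

  totalᵢ : ∀ x → Σ[ l ∈ Lab A ] Σ[ y ∈ IState ] (x ⟶ᵢ[ l ] y)
  totalᵢ (s , bs) with total s
  ... | s'' , st with singleton s''
  ...   | ⊥ₚ , h = τ , (s'' , h) , st , ≐-trans bs (≐-sym h)
  ...   | at a , h =
    let nb : ¬ L s'' ⊥ₚ
        nb l = absurd (proj₁ (h ⊥ₚ) l)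
        (s' , st') = total s''
    in act a , (s' , proj₂ (determ s'' nb st' st')) , s'' , st , proj₂ (h (at a)) refl , st'
    where
    absurd : ⊥ₚ ≡ at a → Data.Empty.⊥
    absurd ()

ks⁻¹ : {A : Set} (K : SKS (Atom A)) → Reversible K → SLTS A
ks⁻¹ K r = record
  { State = IState
  ; _≈_ = λ x y → proj₁ x ≈ proj₁ y
  ; isEquivalence = isEqᵢ
  ; _⟶[_]_ = _⟶ᵢ[_]_
  ; total = totalᵢ
  }
  where open SKS K
        open KsInv K r

record _≅_ {A : Set} (T₁ T₂ : SLTS A) : Set₁ where
  private
    module T₁ = SLTS T₁
    module T₂ = SLTS T₂
  field
    to          : T₁.State → T₂.State
    cong        : ∀ {x y} → x T₁.≈ y → to x T₂.≈ to y
    injective   : ∀ {x y} → to x T₂.≈ to y → x T₁.≈ y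
    surjective  : ∀ y → Σ[ x ∈ T₁.State ] (to x T₂.≈ y)
    transitions : ∀ x l y → (x T₁.⟶[ l ] y) ⇔ (to x T₂.⟶[ l ] to y)

module Submission where

-- The quotient Q = min_KS (ks T) is presented as a setoid of the states of
-- ks T, so the states of ks⁻¹ Q are the ⊥-labelled states of ks T, which
-- are exactly the states of T.  The isomorphism is therefore the identity
-- on states, and the proof consists of three facts:
--   * a generic fact about bisimilarity quotients of Kripke structures:
--     a quotient step [s] → [t] is realised by a concrete step out of any
--     representative of [s] (quotient-step);
--   * Kripke bisimilarity of two states of ks T coincides with strong
--     bisimilarity in T: Kripke simulations restrict to LTS simulations and
--     LTS simulations lift to Kripke simulations;
--   * quotient steps out of a transition state (s, a, t) lead into [t].
-- The last fact gives reversibility of Q; together with quotient-step it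
-- translates each transition of ks⁻¹ Q into a transition of min_LTS T and
-- back, while the bisimilarity correspondence identifies the state
-- equalities of the two quotients.

open import Defs
open import Data.Product using (Σ; Σ-syntax; _×_; _,_; proj₁; proj₂)
open import Data.Sum using (inj₁; inj₂)
open import Data.Empty renaming (⊥ to Empty) using (⊥-elim)
open import Relation.Nullary using (¬_)
open import Relation.Binary.PropositionalEquality using (_≡_; refl; sym)

module QuotientFacts {P : Set} (K : KS P) where
  open KS K
  open KSBisim K
  private module Q = SKS (minKS K)

  bisim-labels : ∀ {s s'} → Bisimilar s s' → L s ≐ L s'
  bisim-labels (_ , sim , _ , r) = proj₁ (sim r)

  bisim-step : ∀ {s s' t} → Bisimilar s s' → s ⟶ t →
               Σ[ t' ∈ State ] ((s' ⟶ t') × Bisimilar t t')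
  bisim-step (R , sim , sy , r) st =
    let (t' , st' , r') = proj₂ (sim r) st in t' , st' , (R , sim , sy , r')

  quotient-step : ∀ {s s₀ t} → Bisimilar s s₀ → s Q.⟶ t →
                  Σ[ t' ∈ State ] ((s₀ ⟶ t') × Bisimilar t t')
  quotient-step b (s₁ , t₁ , b₁ , b₂ , st) =
    let (t' , st' , b') = bisim-step (bisim-trans (bisim-sym b₁) b) st
    in t' , st' , bisim-trans b₂ b'

module Embedding {A : Set} (T : LTS A) where
  open LTS T
  open KsEmbed T
  module KB = KSBisim (ks T)
  module LB = LTSBisim T
  open QuotientFacts (ks T)

  ⊥≢at : ∀ {a : A} → ⊥ₚ ≡ at a → Empty
  ⊥≢at ()

  ⇔-refl : {X : Set} → X ⇔ X
  ⇔-refl = (λ x → x) , (λ x → x)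

  state≁trans : ∀ {s : State} {tr : Trans} → KB.Bisimilar (inj₁ s) (inj₂ tr) → Empty
  state≁trans b = ⊥≢at (proj₁ (bisim-labels b ⊥ₚ) refl)

  trans-not-bot : (tr : Trans) → ¬ IsBot (Lₖ (inj₂ tr))
  trans-not-bot _ b = ⊥≢at (proj₂ (b ⊥ₚ) refl)

  -- A Kripke simulation of ks T, restricted to the states of T, is a strong
  -- simulation of T: a visible step s -a→ t is simulated in ks T by passing
  -- through a transition state labelled a.
  restrict-simulation : (R : KState → KState → Set) → KB.IsSimulation R →
                        LB.IsSimulation (λ x y → R (inj₁ x) (inj₁ y))
  restrict-simulation R sim r {τ} p with proj₂ (sim r) (silent p)
  ... | _ , silent q , r' = _ , q , r'
  ... | _ , into q , r' = ⊥-elim (⊥≢at (proj₁ (proj₁ (sim r') ⊥ₚ) refl))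
  restrict-simulation R sim r {act a} p with proj₂ (sim r) (into p)
  ... | _ , silent q , r' = ⊥-elim (⊥≢at (sym (proj₁ (proj₁ (sim r') (at a)) refl)))
  ... | _ , into {t = t'} q , r' with proj₁ (proj₁ (sim r') (at a)) refl
  ...   | refl with proj₂ (sim r') (outof p)
  ...     | _ , outof _ , r'' = t' , q , r''

  ks-bisim⇒bisim : ∀ {s s'} → KB.Bisimilar (inj₁ s) (inj₁ s') → LB.Bisimilar s s'
  ks-bisim⇒bisim (R , sim , sy , r) =
    (λ x y → R (inj₁ x) (inj₁ y)) , restrict-simulation R sim , sy , r

  liftRel : (State → State → Set) → KState → KState → Set
  liftRel B (inj₁ x) (inj₁ y) = B x y
  liftRel B (inj₂ (_ , a , t , _)) (inj₂ (_ , a' , t' , _)) = (a ≡ a') × B t t'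
  liftRel B _ _ = Empty

  lift-symmetric : ∀ {B} → LB.IsSymmetric B → KB.IsSymmetric (liftRel B)
  lift-symmetric sy {inj₁ _} {inj₁ _} r = sy r
  lift-symmetric sy {inj₂ _} {inj₂ _} (e , r) = sym e , sy r

  lift-simulation : ∀ {B} → LB.IsSimulation B → KB.IsSimulation (liftRel B)
  lift-simulation sim {inj₁ x} {inj₁ y} r = ≐-refl , λ
    { (into p) → let (t' , q , r') = sim r p in inj₂ (y , _ , t' , q) , into q , refl , r'
    ; (silent p) → let (t' , q , r') = sim r p in inj₁ t' , silent q , r' }
  lift-simulation sim {inj₂ (x , a , t , p)} {inj₂ (y , .a , t' , q)} (refl , r) = ≐-refl , λ
    { (outof _) → inj₁ t' , outof q , r }

  bisim⇒ks-bisim : ∀ {s s'} → LB.Bisimilar s s' → KB.Bisimilar (inj₁ s) (inj₁ s')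
  bisim⇒ks-bisim (B , sim , sy , b) =
    liftRel B , lift-simulation sim , (λ {x} {y} → lift-symmetric sy {x} {y}) , b

  Q : SKS (Atom A)
  Q = minKS (ks T)
  module Q = SKS Q

  successor-of-trans : ∀ {x y u a v} {p : u ⟶[ act a ] v} →
                       KB.Bisimilar x (inj₂ (u , a , v , p)) → x Q.⟶ y →
                       KB.Bisimilar y (inj₁ v)
  successor-of-trans b st with quotient-step b st
  ... | _ , outof _ , b' = b'

  -- Q is reversible: labels are singletons by construction of ks T, and a
  -- transition state (u, a, v) only steps into [v], which is ⊥-labelled.
  reversible : Reversible Q
  reversible = record { singleton = singleton ; determ = determ }
    where
    singleton : ∀ s → Σ[ p ∈ Atom A ] (∀ q → Lₖ s q ⇔ (q ≡ p))
    singleton (inj₁ _) = ⊥ₚ , λ _ → ⇔-refl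
    singleton (inj₂ (_ , a , _)) = at a , λ _ → ⇔-refl
    determ : ∀ s → ¬ Lₖ s ⊥ₚ → ∀ {s' s''} → s Q.⟶ s' → s Q.⟶ s'' →
             KB.Bisimilar s' s'' × IsBot (Lₖ s')
    determ (inj₁ _) nb _ _ = ⊥-elim (nb refl)
    determ (inj₂ _) _ st st' =
      KB.bisim-trans (successor-of-trans KB.bisim-refl st)
                     (KB.bisim-sym (successor-of-trans KB.bisim-refl st')) ,
      bisim-labels (successor-of-trans KB.bisim-refl st)

  M : SLTS A
  M = minLTS T
  module M = SLTS M

  quotient-τ⇒τ : ∀ {s s'} → inj₁ s Q.⟶ inj₁ s' → s M.⟶[ τ ] s'
  quotient-τ⇒τ st with quotient-step KB.bisim-refl st
  ... | inj₁ t , silent p , b = _ , t , LB.bisim-refl , ks-bisim⇒bisim b , p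
  ... | inj₂ _ , into _ , b = ⊥-elim (state≁trans b)

  τ⇒quotient-τ : ∀ {s s'} → s M.⟶[ τ ] s' → inj₁ s Q.⟶ inj₁ s'
  τ⇒quotient-τ (s₁ , t₁ , b₁ , b₂ , p) =
    inj₁ s₁ , inj₁ t₁ , bisim⇒ks-bisim b₁ , bisim⇒ks-bisim b₂ , silent p

  quotient-act⇒act : ∀ {s s' a} x → inj₁ s Q.⟶ x → Lₖ x (at a) → x Q.⟶ inj₁ s' →
                     s M.⟶[ act a ] s'
  quotient-act⇒act {a = a} x st l st' with quotient-step KB.bisim-refl st
  ... | inj₁ _ , silent _ , b = ⊥-elim (⊥≢at (sym (proj₁ (bisim-labels b (at a)) l)))
  ... | inj₂ (_ , _ , t , p) , into _ , b with proj₁ (bisim-labels b (at a)) l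
  ...   | refl = _ , t , LB.bisim-refl , ks-bisim⇒bisim (successor-of-trans b st') , p

  act⇒quotient-act : ∀ {s s' a} → s M.⟶[ act a ] s' →
                     Σ[ x ∈ KState ] ((inj₁ s Q.⟶ x) × Lₖ x (at a) × (x Q.⟶ inj₁ s'))
  act⇒quotient-act {a = a} (s₁ , t₁ , b₁ , b₂ , p) =
    inj₂ (s₁ , a , t₁ , p) ,
    (inj₁ s₁ , inj₂ (s₁ , a , t₁ , p) , bisim⇒ks-bisim b₁ , KB.bisim-refl , into p) ,
    refl ,
    (inj₂ (s₁ , a , t₁ , p) , inj₁ t₁ , KB.bisim-refl , bisim⇒ks-bisim b₂ , outof p)

  I : SLTS A
  I = ks⁻¹ Q reversible
  module I = SLTS I

  stateOf : I.State → State
  stateOf (inj₁ s , _) = s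
  stateOf (inj₂ tr , b) = ⊥-elim (trans-not-bot tr b)

  isomorphism : I ≅ M
  isomorphism = record
    { to = stateOf
    ; cong = cong
    ; injective = injective
    ; surjective = λ s → (inj₁ s , λ _ → ⇔-refl) , LB.bisim-refl
    ; transitions = transitions
    }
    where
    cong : ∀ {x y} → x I.≈ y → stateOf x M.≈ stateOf y
    cong {inj₁ _ , _} {inj₁ _ , _} e = ks-bisim⇒bisim e
    cong {inj₂ tr , b} = ⊥-elim (trans-not-bot tr b)
    cong {inj₁ _ , _} {inj₂ tr , b} = ⊥-elim (trans-not-bot tr b)
    injective : ∀ {x y} → stateOf x M.≈ stateOf y → x I.≈ y
    injective {inj₁ _ , _} {inj₁ _ , _} e = bisim⇒ks-bisim e
    injective {inj₂ tr , b} = ⊥-elim (trans-not-bot tr b)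
    injective {inj₁ _ , _} {inj₂ tr , b} = ⊥-elim (trans-not-bot tr b)
    transitions : ∀ x l y → (x I.⟶[ l ] y) ⇔ (stateOf x M.⟶[ l ] stateOf y)
    transitions (inj₂ tr , b) = ⊥-elim (trans-not-bot tr b)
    transitions (inj₁ _ , _) _ (inj₂ tr , b) = ⊥-elim (trans-not-bot tr b)
    transitions (inj₁ _ , _) τ (inj₁ _ , _) =
      (λ (st , _) → quotient-τ⇒τ st) , (λ st → τ⇒quotient-τ st , ≐-refl)
    transitions (inj₁ _ , _) (act _) (inj₁ _ , _) =
      (λ (x , st , l , st') → quotient-act⇒act x st l st') , act⇒quotient-act

theorem4p15 : {A : Set} (T : LTS A) →
    Σ (Reversible (minKS (ks T))) (λ r → ks⁻¹ (minKS (ks T)) r ≅ minLTS T)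
theorem4p15 T = Embedding.reversible T , Embedding.isomorphism T
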